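{- Let $I=(n,m,X_1,\ldots,X_m,\tau)$ be an instance of WPPSG and set $X_0=[n]$. Let $0\le j_1<j_2\le m$, let $\varphi_1\in\mathcal{S}_{X_{j_1}}$, $\varphi_2\in\mathcal{S}_{X_{j_2}}$, and let $\varphi'_2=\varphi_1^{ -1}\varphi_2\varphi_1$. Then $(I[j_1,\varphi_1])[j_2,\varphi'_2]=(I[j_2,\varphi_2])[j_1,\varphi_1]$.
   Context: $\mathcal{S}_n$ is the symmetric group on $[n]=\{1,\ldots,n\}$, with $i\sigma$ the image of $i$ and products composed left to right; $X\sigma=\{i\sigma:i\in X\}$; $\mathcal{S}_X$ is the subgroup fixing every element outside $X$. An instance of WPPSG is $(n,m,X_1,\ldots,X_m,\tau)$ with $X_j\subseteq[n]$, $\tau\in\mathcal{S}_n$. For $\pi\in\mathcal{S}_n$, $I^\pi=(n,m,X_1\pi,\ldots,X_m\pi,\pi^{ -1}\tau\pi)$. For $j'\in[m]$ and a permutation $\varphi$, $I[j',\varphi]=(n,m,X'_1,\ldots,X'_m,\tau\varphi)$ where $X'_j=X_j$ for $j\le j'$ and $X'_j=X_j\varphi$ for $j>j'$; and $I[0,\varphi]=I^\varphi$. -}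

module Defs where

open import Data.Nat using (ℕ; zero; suc; _≤_)
open import Data.Fin using (Fin; toℕ; _<_)
open import Data.Fin.Subset using (Subset; _∈_; _∉_; ⊤)
open import Data.Fin.Permutation using (Permutation′; _⟨$⟩ʳ_; _⟨$⟩ˡ_; _∘ₚ_; flip)
open import Data.Vec using (Vec; tabulate; lookup)
open import Data.Product using (_×_)
open import Relation.Binary.PropositionalEquality using (_≡_)
open import Relation.Nullary using (Dec; yes; no)
open import Data.Nat using (_≤?_)

-- Permutations of [n] are Permutation′ n (bijections Fin n ↔ Fin n).
-- i σ is written  σ ⟨$⟩ʳ i.  Products compose left to right:
-- σ ∘ₚ ρ applies σ first, then ρ (i.e. i(σρ) = (iσ)ρ).

-- Image of a subset under a permutation:  X σ = { i σ : i ∈ X },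
-- i.e.  j ∈ X σ  iff  j σ⁻¹ ∈ X.
_·ˢ_ : ∀ {n} → Subset n → Permutation′ n → Subset n
X ·ˢ σ = tabulate (λ j → lookup X (σ ⟨$⟩ˡ j))

InSym : ∀ {n} → Subset n → Permutation′ n → Set
InSym X σ = ∀ i → i ∉ X → σ ⟨$⟩ʳ i ≡ i

-- An instance of WPPSG with parameters n, m: sets X_1..X_m (X (k) is X_{k+1}) and τ.
record Instance (n m : ℕ) : Set where
  constructor inst
  field
    X : Fin m → Subset n
    τ : Permutation′ n
open Instance public

Xat : ∀ {n m} → Instance n m → Fin (suc m) → Subset n
Xat I Fin.zero = ⊤
Xat I (Fin.suc k) = X I k

_^_ : ∀ {n m} → Instance n m → Permutation′ n → Instance n m
I ^ π = inst (λ k → X I k ·ˢ π) (flip π ∘ₚ (τ I ∘ₚ π))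

-- I[j', φ] for j' ∈ {0,…,m}; I[0, φ] = I^φ.  For j' ≥ 1:
-- X'_j = X_j if j ≤ j', X'_j = X_j φ if j > j'; τ' = τ φ.
-- Index k : Fin m stands for j = toℕ k + 1, so j > j' iff j' ≤ toℕ k.
_[_,_] : ∀ {n m} → Instance n m → Fin (suc m) → Permutation′ n → Instance n m
I [ Fin.zero , φ ] = I ^ φ
I [ Fin.suc j' , φ ] = inst X' (τ I ∘ₚ φ)
  where
  X' : _ → _
  X' k with suc (toℕ j') ≤? toℕ k
  ... | yes _ = X I k ·ˢ φ
  ... | no  _ = X I k

-- Equality of instances (with the same n, m): equal sets, equal permutations
-- (permutations compared pointwise, since Permutation′ is a record of functions).
_≈I_ : ∀ {n m} → Instance n m → Instance n m → Set
I ≈I J = (∀ k → X I k ≡ X J k) × (∀ i → τ I ⟨$⟩ʳ i ≡ τ J ⟨$⟩ʳ i)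

-- Shifting by φ₁ at level j₁ and then by the conjugate φ₁⁻¹φ₂φ₁ at level j₂ moves
-- the sets above j₂ by φ₁φ₁⁻¹φ₂φ₁ = φ₂φ₁ and those strictly between j₁ and j₂ by φ₁,
-- and multiplies τ on the right by φ₂φ₁ (conjugated by φ₁ when j₁ = 0); the other
-- order produces exactly the same data.  This is pure group arithmetic.
module Submission where

open import Defs
open import Data.Nat using (ℕ; _≤_; _≰_; z≤n; _≤?_)
open import Data.Nat.Properties using (≤-trans; <⇒≤)
open import Data.Fin using (Fin; zero; suc; toℕ; _<_)
open import Data.Fin.Permutation using (Permutation′; _⟨$⟩ʳ_; _⟨$⟩ˡ_; _∘ₚ_; flip; inverseˡ)
open import Data.Fin.Subset using (Subset)
open import Data.Vec using (lookup; tabulate)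
open import Data.Vec.Properties using (lookup∘tabulate; tabulate∘lookup; tabulate-cong)
open import Data.Product using (_,_)
open import Relation.Nullary using (yes; no; contradiction)
open import Relation.Binary.PropositionalEquality using (_≡_; refl; sym; trans; cong; module ≡-Reasoning)
open ≡-Reasoning

·ˢ-∘ₚ : ∀ {n} (X : Subset n) (σ ρ : Permutation′ n) → X ·ˢ (σ ∘ₚ ρ) ≡ (X ·ˢ σ) ·ˢ ρ
·ˢ-∘ₚ X σ ρ = tabulate-cong λ j → sym (lookup∘tabulate (λ i → lookup X (σ ⟨$⟩ˡ i)) (ρ ⟨$⟩ˡ j))

·ˢ-flip : ∀ {n} (X : Subset n) (σ : Permutation′ n) → (X ·ˢ σ) ·ˢ flip σ ≡ X
·ˢ-flip X σ = trans
  (tabulate-cong λ j → trans (lookup∘tabulate (λ i → lookup X (σ ⟨$⟩ˡ i)) (σ ⟨$⟩ʳ j))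
                                  (cong (lookup X) (inverseˡ σ)))
  (tabulate∘lookup X)

·ˢ-conjugate : ∀ {n} (X : Subset n) (φ₁ φ₂ : Permutation′ n) →
  (X ·ˢ φ₁) ·ˢ (flip φ₁ ∘ₚ (φ₂ ∘ₚ φ₁)) ≡ (X ·ˢ φ₂) ·ˢ φ₁
·ˢ-conjugate X φ₁ φ₂ = begin
  (X ·ˢ φ₁) ·ˢ (flip φ₁ ∘ₚ (φ₂ ∘ₚ φ₁))  ≡⟨ ·ˢ-∘ₚ (X ·ˢ φ₁) (flip φ₁) (φ₂ ∘ₚ φ₁) ⟩
  ((X ·ˢ φ₁) ·ˢ flip φ₁) ·ˢ (φ₂ ∘ₚ φ₁)  ≡⟨ cong (_·ˢ (φ₂ ∘ₚ φ₁)) (·ˢ-flip X φ₁) ⟩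
  X ·ˢ (φ₂ ∘ₚ φ₁)                       ≡⟨ ·ˢ-∘ₚ X φ₂ φ₁ ⟩
  (X ·ˢ φ₂) ·ˢ φ₁                       ∎

∘ₚ-conjugate : ∀ {n} (σ φ₁ φ₂ : Permutation′ n) i →
  ((σ ∘ₚ φ₁) ∘ₚ (flip φ₁ ∘ₚ (φ₂ ∘ₚ φ₁))) ⟨$⟩ʳ i ≡ ((σ ∘ₚ φ₂) ∘ₚ φ₁) ⟨$⟩ʳ i
∘ₚ-conjugate σ φ₁ φ₂ i = cong (λ x → φ₁ ⟨$⟩ʳ (φ₂ ⟨$⟩ʳ x)) (inverseˡ φ₁)

X-[]-moved : ∀ {n m} (I : Instance n m) j φ k → toℕ j ≤ toℕ k → X (I [ j , φ ]) k ≡ X I k ·ˢ φ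
X-[]-moved I zero    φ k _ = refl
X-[]-moved I (suc j) φ k j≤k with ℕ.suc (toℕ j) ≤? toℕ k
... | yes _   = refl
... | no  j≰k = contradiction j≤k j≰k

X-[]-fixed : ∀ {n m} (I : Instance n m) j φ k → toℕ j ≰ toℕ k → X (I [ j , φ ]) k ≡ X I k
X-[]-fixed I zero    φ k j≰k = contradiction z≤n j≰k
X-[]-fixed I (suc j) φ k j≰k with ℕ.suc (toℕ j) ≤? toℕ k
... | yes j≤k = contradiction j≤k j≰k
... | no  _   = refl

module _ {n m} (I : Instance n m) (φ₁ φ₂ : Permutation′ n) where

  X-[]-[]-comm : ∀ j₁ j₂ → j₁ < j₂ → ∀ k →
    X ((I [ j₁ , φ₁ ]) [ j₂ , flip φ₁ ∘ₚ (φ₂ ∘ₚ φ₁) ]) k ≡ X ((I [ j₂ , φ₂ ]) [ j₁ , φ₁ ]) k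
  X-[]-[]-comm j₁ j₂ j₁<j₂ k with toℕ j₁ ≤? toℕ k | toℕ j₂ ≤? toℕ k
  ... | yes j₁≤k | yes j₂≤k = begin
    X ((I [ j₁ , φ₁ ]) [ j₂ , ψ ]) k
      ≡⟨ trans (X-[]-moved _ j₂ ψ k j₂≤k) (cong (_·ˢ ψ) (X-[]-moved I j₁ φ₁ k j₁≤k)) ⟩
    (X I k ·ˢ φ₁) ·ˢ ψ
      ≡⟨ ·ˢ-conjugate (X I k) φ₁ φ₂ ⟩
    (X I k ·ˢ φ₂) ·ˢ φ₁
      ≡⟨ sym (trans (X-[]-moved _ j₁ φ₁ k j₁≤k) (cong (_·ˢ φ₁) (X-[]-moved I j₂ φ₂ k j₂≤k))) ⟩
    X ((I [ j₂ , φ₂ ]) [ j₁ , φ₁ ]) k ∎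
    where ψ = flip φ₁ ∘ₚ (φ₂ ∘ₚ φ₁)
  ... | yes j₁≤k | no j₂≰k = trans
    (trans (X-[]-fixed _ j₂ _ k j₂≰k) (X-[]-moved I j₁ φ₁ k j₁≤k))
    (sym (trans (X-[]-moved _ j₁ φ₁ k j₁≤k) (cong (_·ˢ φ₁) (X-[]-fixed I j₂ φ₂ k j₂≰k))))
  ... | no j₁≰k | yes j₂≤k = contradiction (≤-trans (<⇒≤ j₁<j₂) j₂≤k) j₁≰k
  ... | no j₁≰k | no j₂≰k = trans
    (trans (X-[]-fixed _ j₂ _ k j₂≰k) (X-[]-fixed I j₁ φ₁ k j₁≰k))
    (sym (trans (X-[]-fixed _ j₁ φ₁ k j₁≰k) (X-[]-fixed I j₂ φ₂ k j₂≰k)))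

  τ-[]-[]-comm : ∀ j₁ j₂ → j₁ < j₂ → ∀ i →
    τ ((I [ j₁ , φ₁ ]) [ j₂ , flip φ₁ ∘ₚ (φ₂ ∘ₚ φ₁) ]) ⟨$⟩ʳ i ≡ τ ((I [ j₂ , φ₂ ]) [ j₁ , φ₁ ]) ⟨$⟩ʳ i
  τ-[]-[]-comm zero    (suc _) _ = ∘ₚ-conjugate (flip φ₁ ∘ₚ τ I) φ₁ φ₂
  τ-[]-[]-comm (suc _) (suc _) _ = ∘ₚ-conjugate (τ I) φ₁ φ₂

lemma5p3 : ∀ {n m} (I : Instance n m) (j₁ j₂ : Fin (ℕ.suc m)) → j₁ < j₂ →
    (φ₁ φ₂ : Permutation′ n) → InSym (Xat I j₁) φ₁ → InSym (Xat I j₂) φ₂ →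
    ((I [ j₁ , φ₁ ]) [ j₂ , flip φ₁ ∘ₚ (φ₂ ∘ₚ φ₁) ]) ≈I ((I [ j₂ , φ₂ ]) [ j₁ , φ₁ ])
lemma5p3 I j₁ j₂ j₁<j₂ φ₁ φ₂ _ _ =
  X-[]-[]-comm I φ₁ φ₂ j₁ j₂ j₁<j₂ , τ-[]-[]-comm I φ₁ φ₂ j₁ j₂ j₁<j₂
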